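{- For all positive integers $a,b,c$: (a) $\chi_3([a,b,c])\le 6\chi_1([a,b,c])$; (b) $\chi_3([a,b,c])\le 3\chi_1([a,b,c])$ when $|\{a,b,c\}|=2$; (c) $\chi_3([a,b,c])\le 3\chi_2([a,b,c])$; (d) $\chi_2([a,b,c])\le 2\chi_1([a,b,c])$.
   Context: For positive integers $p,q,r$ let $\mathcal{CC}_1([p,q,r])=\{[x,x+p]\times[y,y+q]\times[z,z+r]: x,y,z\in\mathbb{Z}\}$. Set $\mathcal{CC}_2([a,b,c])=\mathcal{CC}_1([a,b,c])\cup\mathcal{CC}_1([b,a,c])$ (rotations only in the horizontal $XY$-plane allowed) and $\mathcal{CC}_3([a,b,c])$ = the union of $\mathcal{CC}_1([p,q,r])$ over all permutations $(p,q,r)$ of $(a,b,c)$ (free rotations). For $k\in\{1,2,3\}$, a configuration is a finite subset of $\mathcal{CC}_k([a,b,c])$ whose members have pairwise disjoint interiors; two of its cuboids touch if their intersection is a non-degenerate two-dimensional rectangle; its contact graph has the cuboids as vertices and edges between touching cuboids. $\mathcal{CG}_k([a,b,c])$ is the class of all such contact graphs and $\chi_k([a,b,c])=\max\{\chi(G): G\in\mathcal{CG}_k([a,b,c])\}$, the least number of colors sufficing to properly color every such configuration. -}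

module Defs where

open import Data.Nat using (ℕ; _*_) renaming (_<_ to _<ℕ_)
open import Data.Integer using (ℤ; +_; _+_; _<_)
open import Data.Fin using (Fin)
open import Data.Product using (_×_; Σ; ∃-syntax)
open import Data.Sum using (_⊎_)
open import Relation.Binary.PropositionalEquality using (_≡_; _≢_)

-- An axis-parallel integer cuboid [x,x+p]×[y,y+q]×[z,z+r].
record Cuboid : Set where
  constructor cuboid
  field
    x y z : ℤ
    p q r : ℕ
open Cuboid public

IntOverlap : ℤ → ℕ → ℤ → ℕ → Set
IntOverlap u s v t = (u < v + + t) × (v < u + + s)

IntMeet : ℤ → ℕ → ℤ → ℕ → Set
IntMeet u s v t = (u + + s ≡ v) ⊎ (v + + t ≡ u)

InteriorsMeet : Cuboid → Cuboid → Set
InteriorsMeet A B =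
  IntOverlap (x A) (p A) (x B) (p B) ×
  IntOverlap (y A) (q A) (y B) (q B) ×
  IntOverlap (z A) (r A) (z B) (r B)

-- Two cuboids touch: their intersection is a non-degenerate 2-dimensional
-- rectangle, i.e. along one axis the intervals meet in a single point and
-- along the other two axes the intervals overlap in a segment of positive length.
Touch : Cuboid → Cuboid → Set
Touch A B =
    (IntMeet (x A) (p A) (x B) (p B) ×
     IntOverlap (y A) (q A) (y B) (q B) ×
     IntOverlap (z A) (r A) (z B) (r B))
  ⊎ (IntOverlap (x A) (p A) (x B) (p B) ×
     IntMeet (y A) (q A) (y B) (q B) ×
     IntOverlap (z A) (r A) (z B) (r B))
  ⊎ (IntOverlap (x A) (p A) (x B) (p B) ×
     IntOverlap (y A) (q A) (y B) (q B) ×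
     IntMeet (z A) (r A) (z B) (r B))

-- Which rotations are allowed: CC_1, CC_2, CC_3.
data Kind : Set where
  k1 k2 k3 : Kind

data Allowed : Kind → ℕ → ℕ → ℕ → ℕ → ℕ → ℕ → Set where
  k1-abc : ∀ {a b c} → Allowed k1 a b c a b c
  k2-abc : ∀ {a b c} → Allowed k2 a b c a b c
  k2-bac : ∀ {a b c} → Allowed k2 a b c b a c
  k3-abc : ∀ {a b c} → Allowed k3 a b c a b c
  k3-acb : ∀ {a b c} → Allowed k3 a b c a c b
  k3-bac : ∀ {a b c} → Allowed k3 a b c b a c
  k3-bca : ∀ {a b c} → Allowed k3 a b c b c a
  k3-cab : ∀ {a b c} → Allowed k3 a b c c a b
  k3-cba : ∀ {a b c} → Allowed k3 a b c c b a

IsConfig : Kind → ℕ → ℕ → ℕ → {m : ℕ} → (Fin m → Cuboid) → Set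
IsConfig k a b c C =
  (∀ i → Allowed k a b c (p (C i)) (q (C i)) (r (C i))) ×
  (∀ i j → i ≢ j → InteriorsMeet (C i) (C j) → Data.Empty.⊥)
  where import Data.Empty

ProperColouring : {m : ℕ} → (Fin m → Cuboid) → (n : ℕ) → (Fin m → Fin n) → Set
ProperColouring C n f = ∀ i j → i ≢ j → Touch (C i) (C j) → f i ≢ f j

-- n colours suffice for every graph in CG_k([a,b,c]), i.e. χ_k([a,b,c]) ≤ n.
ColourableBy : Kind → ℕ → ℕ → ℕ → ℕ → Set
ColourableBy k a b c n =
  ∀ (m : ℕ) (C : Fin m → Cuboid) → IsConfig k a b c C →
  ∃[ f ] ProperColouring C n f

ExactlyTwoValues : ℕ → ℕ → ℕ → Set
ExactlyTwoValues a b c =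
    (a ≡ b × a ≢ c)
  ⊎ (a ≡ c × a ≢ b)
  ⊎ (b ≡ c × a ≢ b)

-- Proof idea: permuting the axes of ℤ³ preserves both contact and
-- interior-disjointness of cuboids.  Sort the cuboids of a configuration into
-- K classes by their orientation, so that one fixed axis permutation per class
-- turns each class into a configuration with fewer allowed rotations.
-- Colouring each class with n colours and pairing the class with the colour
-- gives a proper (K * n)-colouring.  For (c) the class is the axis carrying
-- side c, for (d) it is the horizontal orientation, and (a) is (c) after (d).
-- For (b) the class is the axis carrying the side length occurring once.
module Submission where

open import Defs
open import Data.Nat using (ℕ; _*_; _<_)
open import Data.Nat.Properties using (*-assoc)
open import Data.Product using (_×_; _,_; proj₁; proj₂; ∃-syntax)
open import Data.Sum using (inj₁; inj₂)
open import Data.Fin using (Fin; zero; suc; combine)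
open import Data.Fin.Properties using (_≟_; combine-injectiveˡ; combine-injectiveʳ)
open import Data.List using (List; length; lookup; filter; allFin)
import Data.List.Relation.Unary.All as All
open import Data.List.Relation.Unary.All.Properties using (all-filter)
import Data.List.Relation.Unary.Any as Any
open import Data.List.Relation.Unary.Any.Properties using (lookup-index)
open import Data.List.Relation.Unary.AllPairs using (_∷_)
open import Data.List.Relation.Unary.Unique.Propositional using (Unique)
import Data.List.Relation.Unary.Unique.Propositional.Properties as Unique
open import Data.List.Membership.Propositional.Properties using (∈-lookup; ∈-filter⁺; ∈-allFin)
open import Data.Empty using (⊥-elim)
open import Function using (_∘_)
open import Level using (0ℓ)
open import Relation.Nullary using (¬_)
open import Relation.Unary using (Pred; Decidable)
open import Relation.Binary.PropositionalEquality using (_≡_; _≢_; refl; sym; trans; cong; subst; subst₂)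

lookup-injective : ∀ {A : Set} {xs : List A} → Unique xs →
                   ∀ {j j'} → lookup xs j ≡ lookup xs j' → j ≡ j'
lookup-injective (_ ∷ _)      {zero}  {zero}   _  = refl
lookup-injective (x∉xs ∷ _)   {zero}  {suc j'} eq = ⊥-elim (All.lookup x∉xs (∈-lookup j') eq)
lookup-injective (x∉xs ∷ _)   {suc j} {zero}   eq = ⊥-elim (All.lookup x∉xs (∈-lookup j) (sym eq))
lookup-injective (_ ∷ unique) {suc j} {suc j'} eq = cong suc (lookup-injective unique eq)

module Subfamily {m : ℕ} {P : Pred (Fin m) 0ℓ} (P? : Decidable P) where

  members : List (Fin m)
  members = filter P? (allFin m)

  size : ℕ
  size = length members

  member : Fin size → Fin m
  member = lookup members

  member-satisfies : ∀ j → P (member j)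
  member-satisfies j = All.lookup (all-filter P? (allFin m)) (∈-lookup j)

  member-injective : ∀ {j j'} → member j ≡ member j' → j ≡ j'
  member-injective = lookup-injective (Unique.filter⁺ P? (Unique.allFin⁺ m))

  position : ∀ {i} → P i → Fin size
  position {i} Pi = Any.index (∈-filter⁺ P? (∈-allFin i) Pi)

  member-position : ∀ {i} (Pi : P i) → member (position Pi) ≡ i
  member-position {i} Pi = sym (lookup-index (∈-filter⁺ P? (∈-allFin i) Pi))

  position-injective : ∀ {i i'} (Pi : P i) (Pi' : P i') → position Pi ≡ position Pi' → i ≡ i'
  position-injective Pi Pi' eq =
    trans (sym (member-position Pi)) (trans (cong member eq) (member-position Pi'))

AllowedCuboid : Kind → ℕ → ℕ → ℕ → Cuboid → Set
AllowedCuboid k a b c D = Allowed k a b c (p D) (q D) (r D)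

IsConfigOn : Kind → ℕ → ℕ → ℕ → {m : ℕ} → (Fin m → Cuboid) → Pred (Fin m) 0ℓ → Set
IsConfigOn k a b c C P =
  (∀ i → P i → AllowedCuboid k a b c (C i)) ×
  (∀ i j → P i → P j → i ≢ j → ¬ InteriorsMeet (C i) (C j))

ProperColouringOn : {m : ℕ} → (Fin m → Cuboid) → (P : Pred (Fin m) 0ℓ) → (n : ℕ) →
                    (∀ i → P i → Fin n) → Set
ProperColouringOn C P n f =
  ∀ i j (Pi : P i) (Pj : P j) → i ≢ j → Touch (C i) (C j) → f i Pi ≢ f j Pj

colourable-on : ∀ {k a b c n m} {C : Fin m → Cuboid} {P : Pred (Fin m) 0ℓ} →
                ColourableBy k a b c n → Decidable P → IsConfigOn k a b c C P →
                ∃[ f ] ProperColouringOn C P n f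
colourable-on {k} {a} {b} {c} {n} {m} {C} {P} colourable P? (allowed , disjoint) =
  colour , proper
  where
    open Subfamily P?

    sub-config : IsConfig k a b c (C ∘ member)
    sub-config =
        (λ j → allowed (member j) (member-satisfies j))
      , λ j j' j≢j' → disjoint _ _ (member-satisfies j) (member-satisfies j') (j≢j' ∘ member-injective)

    sub-colouring : ∃[ g ] ProperColouring (C ∘ member) n g
    sub-colouring = colourable size (C ∘ member) sub-config

    colour : ∀ i → P i → Fin n
    colour i Pi = proj₁ sub-colouring (position Pi)

    proper : ProperColouringOn C P n colour
    proper i j Pi Pj i≢j touch =
      proj₂ sub-colouring (position Pi) (position Pj) (i≢j ∘ position-injective Pi Pj)
        (subst₂ Touch (cong C (sym (member-position Pi))) (cong C (sym (member-position Pj))) touch)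

record Symmetry : Set where
  field
    act : Cuboid → Cuboid
    preserves-Touch : ∀ {A B} → Touch A B → Touch (act A) (act B)
    reflects-InteriorsMeet : ∀ {A B} → InteriorsMeet (act A) (act B) → InteriorsMeet A B
open Symmetry

identity : Symmetry
identity = record { act = λ A → A ; preserves-Touch = λ t → t ; reflects-InteriorsMeet = λ o → o }

_∘ˢ_ : Symmetry → Symmetry → Symmetry
σ ∘ˢ τ = record
  { act = act σ ∘ act τ
  ; preserves-Touch = preserves-Touch σ ∘ preserves-Touch τ
  ; reflects-InteriorsMeet = reflects-InteriorsMeet τ ∘ reflects-InteriorsMeet σ
  }

swap-xy : Symmetry
swap-xy = record
  { act = λ A → cuboid (y A) (x A) (z A) (q A) (p A) (r A)
  ; preserves-Touch = λ
      { (inj₁ (meet , ov₁ , ov₂))        → inj₂ (inj₁ (ov₁ , meet , ov₂))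
      ; (inj₂ (inj₁ (ov₁ , meet , ov₂))) → inj₁ (meet , ov₁ , ov₂)
      ; (inj₂ (inj₂ (ov₁ , ov₂ , meet))) → inj₂ (inj₂ (ov₂ , ov₁ , meet))
      }
  ; reflects-InteriorsMeet = λ (ov₁ , ov₂ , ov₃) → ov₂ , ov₁ , ov₃
  }

swap-yz : Symmetry
swap-yz = record
  { act = λ A → cuboid (x A) (z A) (y A) (p A) (r A) (q A)
  ; preserves-Touch = λ
      { (inj₁ (meet , ov₁ , ov₂))        → inj₁ (meet , ov₂ , ov₁)
      ; (inj₂ (inj₁ (ov₁ , meet , ov₂))) → inj₂ (inj₂ (ov₁ , ov₂ , meet))
      ; (inj₂ (inj₂ (ov₁ , ov₂ , meet))) → inj₂ (inj₁ (ov₁ , meet , ov₂))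
      }
  ; reflects-InteriorsMeet = λ (ov₁ , ov₂ , ov₃) → ov₁ , ov₃ , ov₂
  }

swap-xz : Symmetry
swap-xz = swap-xy ∘ˢ (swap-yz ∘ˢ swap-xy)

record Reorientation (k k' : Kind) (a b c K : ℕ) : Set where
  field
    class : ∀ {p q r} → Allowed k a b c p q r → Fin K
    rotation : Fin K → Symmetry
    rotates-into : ∀ {D} (o : AllowedCuboid k a b c D) →
                   AllowedCuboid k' a b c (act (rotation (class o)) D)

colourable-by-reorienting : ∀ {k k' a b c K} → Reorientation k k' a b c K →
                            (n : ℕ) → ColourableBy k' a b c n → ColourableBy k a b c (K * n)
colourable-by-reorienting {k' = k'} {a} {b} {c} {K} R n colourable m C (allowed , disjoint) =
  colour , proper
  where
    open Reorientation R

    class-of : Fin m → Fin K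
    class-of i = class (allowed i)

    InClass : Fin K → Pred (Fin m) 0ℓ
    InClass κ i = class-of i ≡ κ

    rotated-allowed : ∀ {κ} i → InClass κ i → AllowedCuboid k' a b c (act (rotation κ) (C i))
    rotated-allowed i refl = rotates-into (allowed i)

    class-config : ∀ κ → IsConfigOn k' a b c (act (rotation κ) ∘ C) (InClass κ)
    class-config κ =
        rotated-allowed
      , λ i j _ _ i≢j → disjoint i j i≢j ∘ reflects-InteriorsMeet (rotation κ)

    class-colouring : ∀ κ → ∃[ f ] ProperColouringOn (act (rotation κ) ∘ C) (InClass κ) n f
    class-colouring κ = colourable-on colourable (λ i → class-of i ≟ κ) (class-config κ)

    colour-in : ∀ κ i → InClass κ i → Fin n
    colour-in κ = proj₁ (class-colouring κ)

    colour-in-own-class : ∀ {κ i} (i∈κ : InClass κ i) →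
                          colour-in (class-of i) i refl ≡ colour-in κ i i∈κ
    colour-in-own-class refl = refl

    colour : Fin m → Fin (K * n)
    colour i = combine (class-of i) (colour-in (class-of i) i refl)

    proper : ProperColouring C (K * n) colour
    proper i j i≢j touch same =
      proj₂ (class-colouring (class-of j)) i j same-class refl i≢j
        (preserves-Touch (rotation (class-of j)) touch)
        (trans (sym (colour-in-own-class same-class)) same-colour)
      where
        same-class : class-of i ≡ class-of j
        same-class = combine-injectiveˡ (class-of i) _ (class-of j) _ same
        same-colour : colour-in (class-of i) i refl ≡ colour-in (class-of j) j refl
        same-colour = combine-injectiveʳ (class-of i) _ (class-of j) _ same

pattern along-x = zero
pattern along-y = suc zero
pattern along-z = suc (suc zero)

axis-of-a axis-of-b axis-of-c : ∀ {a b c p q r} → Allowed k3 a b c p q r → Fin 3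
axis-of-a k3-abc = along-x
axis-of-a k3-acb = along-x
axis-of-a k3-bac = along-y
axis-of-a k3-cab = along-y
axis-of-a k3-bca = along-z
axis-of-a k3-cba = along-z

axis-of-b k3-bac = along-x
axis-of-b k3-bca = along-x
axis-of-b k3-abc = along-y
axis-of-b k3-cba = along-y
axis-of-b k3-acb = along-z
axis-of-b k3-cab = along-z

axis-of-c k3-cab = along-x
axis-of-c k3-cba = along-x
axis-of-c k3-acb = along-y
axis-of-c k3-bca = along-y
axis-of-c k3-abc = along-z
axis-of-c k3-bac = along-z

to-x to-y to-z : Fin 3 → Symmetry
to-x along-x = identity
to-x along-y = swap-xy
to-x along-z = swap-xz

to-y along-x = swap-xy
to-y along-y = identity
to-y along-z = swap-yz

to-z along-x = swap-xz
to-z along-y = swap-yz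
to-z along-z = identity

reorient-k3-k2 : ∀ {a b c} → Reorientation k3 k2 a b c 3
reorient-k3-k2 = record
  { class = axis-of-c
  ; rotation = to-z
  ; rotates-into = λ { k3-abc → k2-abc ; k3-bac → k2-bac ; k3-acb → k2-abc
                     ; k3-bca → k2-bac ; k3-cab → k2-bac ; k3-cba → k2-abc }
  }

reorient-k2-k1 : ∀ {a b c} → Reorientation k2 k1 a b c 2
reorient-k2-k1 = record
  { class = λ { k2-abc → zero ; k2-bac → suc zero }
  ; rotation = λ { zero → identity ; (suc zero) → swap-xy }
  ; rotates-into = λ { k2-abc → k1-abc ; k2-bac → k1-abc }
  }

reorient-aac : ∀ {a c} → Reorientation k3 k1 a a c 3
reorient-aac = record
  { class = axis-of-c
  ; rotation = to-z
  ; rotates-into = λ { k3-abc → k1-abc ; k3-bac → k1-abc ; k3-acb → k1-abc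
                     ; k3-bca → k1-abc ; k3-cab → k1-abc ; k3-cba → k1-abc }
  }

reorient-aba : ∀ {a b} → Reorientation k3 k1 a b a 3
reorient-aba = record
  { class = axis-of-b
  ; rotation = to-y
  ; rotates-into = λ { k3-abc → k1-abc ; k3-bac → k1-abc ; k3-acb → k1-abc
                     ; k3-bca → k1-abc ; k3-cab → k1-abc ; k3-cba → k1-abc }
  }

reorient-abb : ∀ {a b} → Reorientation k3 k1 a b b 3
reorient-abb = record
  { class = axis-of-a
  ; rotation = to-x
  ; rotates-into = λ { k3-abc → k1-abc ; k3-bac → k1-abc ; k3-acb → k1-abc
                     ; k3-bca → k1-abc ; k3-cab → k1-abc ; k3-cba → k1-abc }
  }

k3-of-k1-two-values : ∀ a b c → ExactlyTwoValues a b c →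
                      (n : ℕ) → ColourableBy k1 a b c n → ColourableBy k3 a b c (3 * n)
k3-of-k1-two-values a .a c (inj₁ (refl , _))        = colourable-by-reorienting reorient-aac
k3-of-k1-two-values a b .a (inj₂ (inj₁ (refl , _))) = colourable-by-reorienting reorient-aba
k3-of-k1-two-values a b .b (inj₂ (inj₂ (refl , _))) = colourable-by-reorienting reorient-abb

k3-of-k1 : ∀ {a b c} (n : ℕ) → ColourableBy k1 a b c n → ColourableBy k3 a b c (6 * n)
k3-of-k1 {a} {b} {c} n colourable =
  subst (ColourableBy k3 a b c) (sym (*-assoc 3 2 n))
    (colourable-by-reorienting reorient-k3-k2 (2 * n)
      (colourable-by-reorienting reorient-k2-k1 n colourable))

lemma2p2 : (a b c : ℕ) → 0 < a → 0 < b → 0 < c →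
    ((n : ℕ) → ColourableBy k1 a b c n → ColourableBy k3 a b c (6 * n)) ×
    (ExactlyTwoValues a b c →
      (n : ℕ) → ColourableBy k1 a b c n → ColourableBy k3 a b c (3 * n)) ×
    ((n : ℕ) → ColourableBy k2 a b c n → ColourableBy k3 a b c (3 * n)) ×
    ((n : ℕ) → ColourableBy k1 a b c n → ColourableBy k2 a b c (2 * n))
lemma2p2 a b c _ _ _ =
    k3-of-k1
  , k3-of-k1-two-values a b c
  , colourable-by-reorienting reorient-k3-k2
  , colourable-by-reorienting reorient-k2-k1
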